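{- Let $n\ge2$ and let $[q^a]A_n(q)$ denote the coefficient of $q^a$ in the Armstrong polynomial $A_n(q)$. Then (1) $[q^{2^n}]A_n(q)=1$; (2) $[q^{n+1}]A_n(q)=T(1^{n-1})$; (3) $[q^{3\cdot 2^{n-2}}]A_n(q)=2^n-n-1$.
   Context: Let $U_n$ be the set of $n\times n$ upper-triangular matrices with nonnegative integer entries. For $A=(a_{i,j})\in U_n$, the $k$-th hook sum is $h_k=(a_{k,k}+\cdots+a_{k,n})-(a_{1,k}+\cdots+a_{k-1,k})$. A Tesler matrix is one with $h_k=1$ for all $1\le k\le n$; $\mathcal{T}(1^n)$ is the set of $n\times n$ Tesler matrices and $T(1^n)=|\mathcal{T}(1^n)|$. The diagonal product of $A$ is $\mathrm{dpro}(A)=\prod_{i=1}^n(a_{ii}+1)$, and the Armstrong polynomial is $A_n(q)=\sum_{A\in\mathcal{T}(1^n)}q^{\mathrm{dpro}(A)}$. -}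

module Defs where

open import Data.Nat using (ℕ; _+_; _<_; _≤ᵇ_; _<ᵇ_)
open import Data.Bool using (if_then_else_)
open import Data.Integer using (ℤ; +_; _-_)
open import Data.Fin using (Fin; toℕ)
open import Data.Vec using (Vec; lookup)
open import Data.List using (List; length; map; allFin)
open import Data.Nat.ListAction using (sum; product)
open import Data.List.Relation.Unary.All using (All)
open import Data.List.Relation.Unary.Unique.Propositional using (Unique)
open import Data.List.Membership.Propositional using (_∈_)
open import Data.Product using (Σ; _×_)
open import Relation.Binary.PropositionalEquality using (_≡_)

Mat : ℕ → Set
Mat n = Vec (Vec ℕ n) n

entry : ∀ {n} → Mat n → Fin n → Fin n → ℕ
entry A i j = lookup (lookup A i) j

UpperTriangular : ∀ {n} → Mat n → Set
UpperTriangular {n} A = ∀ (i j : Fin n) → toℕ j < toℕ i → entry A i j ≡ 0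

rowTail : ∀ {n} → Mat n → Fin n → ℕ
rowTail {n} A k = sum (map (λ j → if toℕ k ≤ᵇ toℕ j then entry A k j else 0) (allFin n))

colHead : ∀ {n} → Mat n → Fin n → ℕ
colHead {n} A k = sum (map (λ i → if toℕ i <ᵇ toℕ k then entry A i k else 0) (allFin n))

hook : ∀ {n} → Mat n → Fin n → ℤ
hook A k = + rowTail A k - + colHead A k

Tesler : (n : ℕ) → Mat n → Set
Tesler n A = UpperTriangular A × (∀ (k : Fin n) → hook A k ≡ + 1)

dpro : ∀ {n} → Mat n → ℕ
dpro {n} A = product (map (λ i → entry A i i + 1) (allFin n))

-- "the set {x | P x} is finite with exactly c elements":
-- a duplicate-free list of exactly the elements satisfying P, of length c
HasCount : {X : Set} → (X → Set) → ℕ → Set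
HasCount {X} P c =
  Σ (List X) (λ xs → Unique xs × All P xs × (∀ x → P x → x ∈ xs) × length xs ≡ c)

-- [q^a] A_n(q) = c   (coefficient = number of Tesler matrices with dpro = a)
ArmstrongCoeff : (n a c : ℕ) → Set
ArmstrongCoeff n a c = HasCount (λ A → Tesler n A × dpro A ≡ a) c

TeslerCount : (n c : ℕ) → Set
TeslerCount n c = HasCount (Tesler n) c

module Submission where

-- Tesler matrices are generalised to upper-triangular matrices with an arbitrary hook vector h
-- (`HasHooks h A`), analysed by peeling off the first row: cons a r B has hooks h ∷ hs iff
-- a + Σ r = h and B has hooks hs ⊕ r.  This yields the trace formula Σ diag A = Σ h, a bound on
-- the entries (so T(1^n) exists), and that the identity is the only Tesler matrix with unit diagonal.
--
-- For a diagonal d put P d = ∏ (dᵢ + 1) (so dpro A = P (diag A)) and T d = 2^(Σ d) (= 2^n for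
-- Tesler matrices).  Then P = T if all dᵢ ≤ 1, 4P = 3T if d has a single 2 and otherwise entries
-- ≤ 1 ("OneTwo"), and 16P ≤ 9T in every other case; moreover P ≥ 1 + Σ d with equality only if
-- at most one dᵢ is nonzero.  Consequently:
--   (1) dpro = 2^n forces a 0/1 diagonal, hence the identity;
--   (3) dpro = 3·2^(n-2) means a OneTwo diagonal; these matrices are counted by a recursion on
--       the first row, through the auxiliary hook vectors `bump s` (a 2 in position s);
--   (2) dpro = n + 1 forces the diagonal to vanish except in the last entry, and moving each
--       diagonal entry to the end of its row (`pushDiag`) is a bijection from 𝒯(1^(n-1)).

open import Defs
open import Data.Nat using (ℕ; zero; suc; _+_; _*_; _∸_; _^_; _≤_; z≤n; s≤s; NonZero; _≤ᵇ_; _<ᵇ_; _≤?_; _<?_; _≟_)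
open import Data.Nat.Properties
open import Data.Nat.ListAction using (sum; product)
open import Data.Nat.Solver using (module +-*-Solver)
open import Data.Bool using (if_then_else_)
import Data.Integer as ℤ
import Data.Integer.Properties as ℤ
open import Data.Fin using (Fin; zero; suc; toℕ)
import Data.Fin.Properties as Fin
open import Data.Product using (_×_; Σ; _,_; proj₁; proj₂)
open import Data.Sum using (_⊎_; inj₁; inj₂)
open import Data.Empty using (⊥; ⊥-elim)
open import Function using (_∘_; id)
open import Data.List as List using (List; []; _∷_; _++_; length; filter)
open import Data.List.Properties using (length-++; length-map; map-tabulate; map-cong; map-∘; length-tabulate)
open import Data.List.Relation.Unary.All as All using (All; []; _∷_)
import Data.List.Relation.Unary.All.Properties as All
open import Data.List.Relation.Unary.AllPairs using ([]; _∷_)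
open import Data.List.Relation.Unary.Any using (here)
open import Data.List.Membership.Propositional using (_∈_)
open import Data.List.Relation.Unary.Unique.Propositional using (Unique)
import Data.List.Relation.Unary.Unique.Propositional.Properties as Unique
import Data.List.Membership.Propositional.Properties as ∈
open import Data.Vec as Vec using (Vec; []; _∷_; lookup; _∷ʳ_)
import Data.Vec.Properties as Vec
open import Relation.Binary.PropositionalEquality
open import Relation.Nullary using (¬_; Dec)
open import Relation.Nullary.Decidable using (_×-dec_; _→-dec_; toWitness; toWitnessFalse)
open import Relation.Unary using (Decidable)

open import Algebra.Properties.CommutativeSemigroup *-commutativeSemigroup
  using () renaming (x∙yz≈y∙xz to *-exchange)
open +-*-Solver using (solve; _:=_; _:+_; _:*_; con)

module _ {X : Set} where

  count-cong : ∀ {P Q : X → Set} {c} → (∀ x → P x → Q x) → (∀ x → Q x → P x) →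
               HasCount P c → HasCount Q c
  count-cong P⇒Q Q⇒P (xs , unique , all , complete , len) =
    xs , unique , All.map (P⇒Q _) all , (λ x q → complete x (Q⇒P x q)) , len

  count-none : ∀ {P : X → Set} → (∀ x → ¬ P x) → HasCount P 0
  count-none ¬P = [] , [] , [] , (λ x p → ⊥-elim (¬P x p)) , refl

  count-single : (x₀ : X) → HasCount (_≡ x₀) 1
  count-single x₀ = x₀ ∷ [] , [] ∷ [] , refl ∷ [] , (λ { x refl → here refl }) , refl

  count-⊎ : ∀ {P Q : X → Set} {a b} → HasCount P a → HasCount Q b → (∀ x → P x → Q x → ⊥) →
            HasCount (λ x → P x ⊎ Q x) (a + b)
  count-⊎ (xs , uxs , Pxs , cxs , refl) (ys , uys , Qys , cys , refl) disjoint =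
    xs ++ ys ,
    Unique.++⁺ uxs uys (λ (i , j) → disjoint _ (All.lookup Pxs i) (All.lookup Qys j)) ,
    All.++⁺ (All.map inj₁ Pxs) (All.map inj₂ Qys) ,
    (λ { x (inj₁ p) → ∈.∈-++⁺ˡ (cxs x p) ; x (inj₂ q) → ∈.∈-++⁺ʳ xs (cys x q) }) ,
    length-++ xs

  count-filter : ∀ {P : X → Set} (P? : Decidable P) (xs : List X) → Unique xs →
                 (∀ x → P x → x ∈ xs) → HasCount P (length (filter P? xs))
  count-filter P? xs unique complete =
    filter P? xs , Unique.filter⁺ P? unique , All.all-filter P? xs ,
    (λ x p → ∈.∈-filter⁺ P? (complete x p) p) , refl

count-image : ∀ {X Y : Set} {P : X → Set} {c} (f : X → Y) →
              (∀ {x y} → P x → P y → f x ≡ f y → x ≡ y) → HasCount P c →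
              HasCount (λ y → Σ X λ x → P x × f x ≡ y) c
count-image {P = P} f inj (xs , unique , Pxs , complete , len) =
  List.map f xs , unique-map Pxs unique ,
  All.map⁺ (All.map (λ p → _ , p , refl) Pxs) ,
  (λ { y (x , p , refl) → ∈.∈-map⁺ f (complete x p) }) ,
  trans (length-map f xs) len
  where
    unique-map : ∀ {ys} → All P ys → Unique ys → Unique (List.map f ys)
    unique-map [] [] = []
    unique-map (p ∷ ps) (distinct ∷ unique) = separated p ps distinct ∷ unique-map ps unique
      where
        separated : ∀ {x zs} → P x → All P zs → All (x ≢_) zs → All (f x ≢_) (List.map f zs)
        separated p [] [] = []
        separated p (q ∷ qs) (x≢z ∷ x≢zs) = (λ fx≡fz → x≢z (inj p q fx≡fz)) ∷ separated p qs x≢zs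

sumFin : ∀ {n} → (Fin n → ℕ) → ℕ
sumFin {zero} c = 0
sumFin {suc n} c = c zero + sumFin (c ∘ suc)

count-⋃ : ∀ {X : Set} n (P : Fin n → X → Set) (c : Fin n → ℕ) → (∀ s → HasCount (P s) (c s)) →
          (∀ s t x → P s x → P t x → s ≡ t) → HasCount (λ x → Σ (Fin n) λ s → P s x) (sumFin c)
count-⋃ zero P c counts disjoint = count-none (λ { x (() , _) })
count-⋃ (suc n) P c counts disjoint =
  count-cong (λ { x (inj₁ p) → zero , p ; x (inj₂ (t , p)) → suc t , p })
             (λ { x (zero , p) → inj₁ p ; x (suc t , p) → inj₂ (t , p) })
    (count-⊎ (counts zero)
             (count-⋃ n (P ∘ suc) (c ∘ suc) (counts ∘ suc)
               (λ s t x p q → Fin.suc-injective (disjoint (suc s) (suc t) x p q)))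
             (λ x p (t , q) → zero≢suc (disjoint zero (suc t) x p q)))
  where
    zero≢suc : ∀ {t : Fin n} → zero ≢ suc t
    zero≢suc ()

cons : ∀ {n} → ℕ → Vec ℕ n → Mat n → Mat (suc n)
cons a r B = (a ∷ r) ∷ Vec.map (0 ∷_) B

infixl 6 _⊕_
_⊕_ : ∀ {n} → Vec ℕ n → Vec ℕ n → Vec ℕ n
_⊕_ = Vec.zipWith _+_

ones : ∀ {n} → Vec ℕ n
ones {zero} = []
ones {suc n} = 1 ∷ ones

zeros : ∀ {n} → Vec ℕ n
zeros {zero} = []
zeros {suc n} = 0 ∷ zeros

-- A has hook vector h (over ℕ, so no integer subtraction is involved).
HasHooks : ∀ {n} → Vec ℕ n → Mat n → Set
HasHooks h A = UpperTriangular A × (∀ k → rowTail A k ≡ lookup h k + colHead A k)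

diagonal : ∀ {n} → Mat n → List ℕ
diagonal {n} A = List.map (λ i → entry A i i) (List.allFin n)

private
  map-allFin : ∀ {n} {B : Set} (f : Fin (suc n) → B) →
               List.map f (List.allFin (suc n)) ≡ f zero ∷ List.map (f ∘ suc) (List.allFin n)
  map-allFin f = cong (f zero ∷_) (trans (map-tabulate suc f) (sym (map-tabulate id (f ∘ suc))))

  sum-lookup : ∀ {n} (r : Vec ℕ n) → sum (List.map (lookup r) (List.allFin n)) ≡ Vec.sum r
  sum-lookup [] = refl
  sum-lookup (x ∷ r) = trans (cong sum (map-allFin (lookup (x ∷ r)))) (cong (x +_) (sum-lookup r))

  sum-zero : ∀ {A : Set} (xs : List A) → sum (List.map (λ _ → 0) xs) ≡ 0
  sum-zero [] = refl
  sum-zero (x ∷ xs) = sum-zero xs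

  <ᵇ-suc : ∀ x y → (x <ᵇ suc y) ≡ (x ≤ᵇ y)
  <ᵇ-suc zero y = refl
  <ᵇ-suc (suc x) y = refl

module _ {n} {a : ℕ} {r : Vec ℕ n} {B : Mat n} where

  entry-cons : ∀ i j → entry (cons a r B) (suc i) (suc j) ≡ entry B i j
  entry-cons i j = cong (λ row → lookup row (suc j)) (Vec.lookup-map i (0 ∷_) B)

  entry-cons-col₀ : ∀ i → entry (cons a r B) (suc i) zero ≡ 0
  entry-cons-col₀ i = cong (λ row → lookup row zero) (Vec.lookup-map i (0 ∷_) B)

  rowTail-cons₀ : rowTail (cons a r B) zero ≡ a + Vec.sum r
  rowTail-cons₀ = trans (cong sum (map-allFin (λ j → if 0 ≤ᵇ toℕ j then entry (cons a r B) zero j else 0)))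
                        (cong (a +_) (sum-lookup r))

  colHead-cons₀ : colHead (cons a r B) zero ≡ 0
  colHead-cons₀ = sum-zero (List.allFin (suc n))

  rowTail-cons : ∀ k → rowTail (cons a r B) (suc k) ≡ rowTail B k
  rowTail-cons k =
    trans (cong sum (map-allFin (λ j → if toℕ (suc k) ≤ᵇ toℕ j then entry (cons a r B) (suc k) j else 0)))
          (cong sum (map-cong term (List.allFin n)))
    where
      term : ∀ j → (if toℕ k <ᵇ suc (toℕ j) then entry (cons a r B) (suc k) (suc j) else 0)
                 ≡ (if toℕ k ≤ᵇ toℕ j then entry B k j else 0)
      term j rewrite <ᵇ-suc (toℕ k) (toℕ j) | entry-cons k j = refl

  colHead-cons : ∀ k → colHead (cons a r B) (suc k) ≡ lookup r k + colHead B k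
  colHead-cons k =
    trans (cong sum (map-allFin (λ i → if toℕ i <ᵇ toℕ (suc k) then entry (cons a r B) i (suc k) else 0)))
          (cong (lookup r k +_) (cong sum (map-cong term (List.allFin n))))
    where
      term : ∀ i → (if toℕ i <ᵇ toℕ k then entry (cons a r B) (suc i) (suc k) else 0)
                 ≡ (if toℕ i <ᵇ toℕ k then entry B i k else 0)
      term i rewrite entry-cons i k = refl

  diagonal-cons : diagonal (cons a r B) ≡ a ∷ diagonal B
  diagonal-cons = trans (map-allFin (λ i → entry (cons a r B) i i))
                        (cong (a ∷_) (map-cong (λ i → entry-cons i i) (List.allFin n)))

  upper-cons⁻ : UpperTriangular (cons a r B) → UpperTriangular B
  upper-cons⁻ ut i j j<i = trans (sym (entry-cons i j)) (ut (suc i) (suc j) (s≤s j<i))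

  upper-cons⁺ : UpperTriangular B → UpperTriangular (cons a r B)
  upper-cons⁺ ut zero j ()
  upper-cons⁺ ut (suc i) zero _ = entry-cons-col₀ i
  upper-cons⁺ ut (suc i) (suc j) (s≤s j<i) = trans (entry-cons i j) (ut i j j<i)

  -- Peeling the first row: cons a r B has hooks h ∷ hs exactly when the first row sums
  -- to h and B has hooks hs ⊕ r (the first row feeds the column heads of B).
  hooks-cons⁻ : ∀ {h hs} → HasHooks (h ∷ hs) (cons a r B) → (a + Vec.sum r ≡ h) × HasHooks (hs ⊕ r) B
  hooks-cons⁻ {h} {hs} (ut , hooks) =
    trans (sym rowTail-cons₀) (trans (hooks zero) (trans (cong (h +_) colHead-cons₀) (+-identityʳ h))) ,
    upper-cons⁻ ut , λ k → begin
      rowTail B k                                  ≡⟨ sym (rowTail-cons k) ⟩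
      rowTail (cons a r B) (suc k)                 ≡⟨ hooks (suc k) ⟩
      lookup hs k + colHead (cons a r B) (suc k)   ≡⟨ cong (lookup hs k +_) (colHead-cons k) ⟩
      lookup hs k + (lookup r k + colHead B k)     ≡⟨ sym (+-assoc (lookup hs k) _ _) ⟩
      lookup hs k + lookup r k + colHead B k       ≡⟨ cong (_+ colHead B k) (sym (Vec.lookup-zipWith _+_ k hs r)) ⟩
      lookup (hs ⊕ r) k + colHead B k              ∎
    where open ≡-Reasoning

  hooks-cons⁺ : ∀ {h hs} → a + Vec.sum r ≡ h → HasHooks (hs ⊕ r) B → HasHooks (h ∷ hs) (cons a r B)
  hooks-cons⁺ {h} {hs} row (ut , hooks) = upper-cons⁺ ut , λ
    { zero → trans rowTail-cons₀ (trans row (trans (sym (+-identityʳ h)) (cong (h +_) (sym colHead-cons₀))))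
    ; (suc k) → begin
        rowTail (cons a r B) (suc k)                 ≡⟨ rowTail-cons k ⟩
        rowTail B k                                  ≡⟨ hooks k ⟩
        lookup (hs ⊕ r) k + colHead B k              ≡⟨ cong (_+ colHead B k) (Vec.lookup-zipWith _+_ k hs r) ⟩
        lookup hs k + lookup r k + colHead B k       ≡⟨ +-assoc (lookup hs k) _ _ ⟩
        lookup hs k + (lookup r k + colHead B k)     ≡⟨ cong (lookup hs k +_) (sym (colHead-cons k)) ⟩
        lookup hs k + colHead (cons a r B) (suc k)   ∎ }
    where open ≡-Reasoning

data FirstRowView {n} : Mat (suc n) → Set where
  firstRow : ∀ a r B → FirstRowView (cons a r B)

firstRowView : ∀ {n} (A : Mat (suc n)) → UpperTriangular A → FirstRowView A
firstRowView ((a ∷ r) ∷ rows) ut =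
  subst (λ rs → FirstRowView ((a ∷ r) ∷ rs)) (sym (rows≡ rows (λ i → ut (suc i) zero (s≤s z≤n))))
        (firstRow a r (Vec.map Vec.tail rows))
  where
    rows≡ : ∀ {m k} (rs : Vec (Vec ℕ (suc k)) m) → (∀ i → lookup (lookup rs i) zero ≡ 0) →
            rs ≡ Vec.map (0 ∷_) (Vec.map Vec.tail rs)
    rows≡ [] _ = refl
    rows≡ ((x ∷ row) ∷ rs) col₀ with col₀ zero
    ... | refl = cong ((0 ∷ row) ∷_) (rows≡ rs (col₀ ∘ suc))

cons-injective : ∀ {n a a′ r r′} {B B′ : Mat n} → cons a r B ≡ cons a′ r′ B′ → a ≡ a′ × r ≡ r′ × B ≡ B′
cons-injective eq with Vec.∷-injective eq
... | row₀ , rest with Vec.∷-injective row₀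
... | refl , refl = refl , refl , block rest
  where
    block : ∀ {m k} {C C′ : Vec (Vec ℕ k) m} → Vec.map (0 ∷_) C ≡ Vec.map (0 ∷_) C′ → C ≡ C′
    block {C = []} {[]} _ = refl
    block {C = x ∷ C} {y ∷ C′} eq with Vec.∷-injective eq
    ... | e₁ , e₂ = cong₂ _∷_ (Vec.∷-injectiveʳ e₁) (block e₂)

cons-injectiveʳ : ∀ {n a} {r : Vec ℕ n} {B B′ : Mat n} → cons a r B ≡ cons a r B′ → B ≡ B′
cons-injectiveʳ eq = proj₂ (proj₂ (cons-injective eq))

private
  ⊖≡1⇒ : ∀ m n → m ℤ.⊖ n ≡ ℤ.+ 1 → m ≡ suc n
  ⊖≡1⇒ m zero eq = ℤ.+-injective eq
  ⊖≡1⇒ zero (suc n) ()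
  ⊖≡1⇒ (suc m) (suc n) eq = cong suc (⊖≡1⇒ m n (trans (sym (ℤ.[1+m]⊖[1+n]≡m⊖n m n)) eq))

  suc⊖≡1 : ∀ n → suc n ℤ.⊖ n ≡ ℤ.+ 1
  suc⊖≡1 zero = refl
  suc⊖≡1 (suc n) = trans (ℤ.[1+m]⊖[1+n]≡m⊖n (suc n) n) (suc⊖≡1 n)

lookup-ones : ∀ {n} (k : Fin n) → lookup ones k ≡ 1
lookup-ones zero = refl
lookup-ones (suc k) = lookup-ones k

tesler⇒hooks : ∀ {n} {A : Mat n} → Tesler n A → HasHooks ones A
tesler⇒hooks {A = A} (ut , hook≡1) = ut , λ k →
  trans (⊖≡1⇒ _ _ (trans (sym (ℤ.m-n≡m⊖n (rowTail A k) (colHead A k))) (hook≡1 k)))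
        (cong (_+ colHead A k) (sym (lookup-ones k)))

hooks⇒tesler : ∀ {n} {A : Mat n} → HasHooks ones A → Tesler n A
hooks⇒tesler {A = A} (ut , hooks) = ut , λ k →
  trans (ℤ.m-n≡m⊖n (rowTail A k) (colHead A k))
        (subst (λ x → x ℤ.⊖ colHead A k ≡ ℤ.+ 1)
               (sym (trans (hooks k) (cong (_+ colHead A k) (lookup-ones k))))
               (suc⊖≡1 (colHead A k)))

sum-ones : ∀ {n} → Vec.sum (ones {n}) ≡ n
sum-ones {zero} = refl
sum-ones {suc n} = cong suc sum-ones

sum-zeros : ∀ {n} → Vec.sum (zeros {n}) ≡ 0
sum-zeros {zero} = refl
sum-zeros {suc n} = sum-zeros {n}

sum-⊕ : ∀ {n} (u v : Vec ℕ n) → Vec.sum (u ⊕ v) ≡ Vec.sum u + Vec.sum v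
sum-⊕ [] [] = refl
sum-⊕ (x ∷ u) (y ∷ v) = trans (cong (x + y +_) (sum-⊕ u v))
  (solve 4 (λ x y s t → x :+ y :+ (s :+ t) := x :+ s :+ (y :+ t)) refl x y (Vec.sum u) (Vec.sum v))

⊕-zeros : ∀ {n} (v : Vec ℕ n) → v ⊕ zeros ≡ v
⊕-zeros [] = refl
⊕-zeros (x ∷ v) = cong₂ _∷_ (+-identityʳ x) (⊕-zeros v)

sum≡0⇒zeros : ∀ {n} (r : Vec ℕ n) → Vec.sum r ≡ 0 → r ≡ zeros
sum≡0⇒zeros [] _ = refl
sum≡0⇒zeros (zero ∷ r) eq = cong (0 ∷_) (sum≡0⇒zeros r eq)

lookup≤sum : ∀ {n} (v : Vec ℕ n) i → lookup v i ≤ Vec.sum v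
lookup≤sum (x ∷ v) zero = m≤m+n x (Vec.sum v)
lookup≤sum (x ∷ v) (suc i) = ≤-trans (lookup≤sum v i) (m≤n+m (Vec.sum v) x)

unit : ∀ {n} → Fin n → Vec ℕ n
unit zero = 1 ∷ zeros
unit (suc t) = 0 ∷ unit t

sum-unit : ∀ {n} (s : Fin n) → Vec.sum (unit s) ≡ 1
sum-unit {suc n} zero = cong suc (sum-zeros {n})
sum-unit (suc s) = sum-unit s

sum≡1⇒unit : ∀ {n} (r : Vec ℕ n) → Vec.sum r ≡ 1 → Σ (Fin n) λ s → r ≡ unit s
sum≡1⇒unit (zero ∷ r) eq with sum≡1⇒unit r eq
... | s , refl = suc s , refl
sum≡1⇒unit (suc zero ∷ r) eq = zero , cong (1 ∷_) (sum≡0⇒zeros r (suc-injective eq))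

unit-injective : ∀ {n} {s t : Fin n} → unit s ≡ unit t → s ≡ t
unit-injective {s = zero} {zero} _ = refl
unit-injective {s = suc s} {suc t} eq = cong suc (unit-injective (Vec.∷-injectiveʳ eq))

HasHooks-subst : ∀ {n} {h h′ : Vec ℕ n} (B : Mat n) → h ≡ h′ → HasHooks h B → HasHooks h′ B
HasHooks-subst B eq = subst (λ x → HasHooks x B) eq

length-diagonal : ∀ {n} (A : Mat n) → length (diagonal A) ≡ n
length-diagonal {n} A = trans (length-map _ (List.allFin n)) (length-tabulate id)

trace : ∀ {n} (h : Vec ℕ n) (A : Mat n) → HasHooks h A → sum (diagonal A) ≡ Vec.sum h
trace [] [] _ = refl
trace (h ∷ hs) A hooks with firstRowView A (proj₁ hooks)
... | firstRow a r B with hooks-cons⁻ hooks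
... | row , hooksB = begin
  sum (diagonal (cons a r B))   ≡⟨ cong sum (diagonal-cons {a = a} {r = r} {B = B}) ⟩
  a + sum (diagonal B)          ≡⟨ cong (a +_) (trace (hs ⊕ r) B hooksB) ⟩
  a + Vec.sum (hs ⊕ r)          ≡⟨ cong (a +_) (sum-⊕ hs r) ⟩
  a + (Vec.sum hs + Vec.sum r)  ≡⟨ solve 3 (λ a s t → a :+ (s :+ t) := a :+ t :+ s) refl a (Vec.sum hs) (Vec.sum r) ⟩
  a + Vec.sum r + Vec.sum hs    ≡⟨ cong (_+ Vec.sum hs) row ⟩
  h + Vec.sum hs                ∎
  where open ≡-Reasoning

trace-tesler : ∀ {n} (A : Mat n) → HasHooks ones A → sum (diagonal A) ≡ n
trace-tesler {n} A hooks = trans (trace ones A hooks) (sum-ones {n})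

entry≤sum : ∀ {n} (h : Vec ℕ n) (A : Mat n) → HasHooks h A → ∀ i j → entry A i j ≤ Vec.sum h
entry≤sum (h ∷ hs) A hooks i j with firstRowView A (proj₁ hooks)
... | firstRow a r B with hooks-cons⁻ hooks
... | row , hooksB with i | j
... | zero | j = ≤-trans (lookup≤sum (a ∷ r) j) (≤-trans (≤-reflexive row) (m≤m+n h (Vec.sum hs)))
... | suc i | zero = ≤-trans (≤-reflexive (entry-cons-col₀ {a = a} {r = r} {B = B} i)) z≤n
... | suc i | suc j = begin
  entry (cons a r B) (suc i) (suc j)  ≡⟨ entry-cons {a = a} {r = r} {B = B} i j ⟩
  entry B i j                         ≤⟨ entry≤sum (hs ⊕ r) B hooksB i j ⟩
  Vec.sum (hs ⊕ r)                    ≡⟨ sum-⊕ hs r ⟩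
  Vec.sum hs + Vec.sum r              ≤⟨ +-monoʳ-≤ (Vec.sum hs) (≤-trans (m≤n+m (Vec.sum r) a) (≤-reflexive row)) ⟩
  Vec.sum hs + h                      ≡⟨ +-comm (Vec.sum hs) h ⟩
  h + Vec.sum hs                      ∎
  where open ≤-Reasoning

vectors : ∀ {A : Set} → List A → (m : ℕ) → List (Vec A m)
vectors xs zero = [] ∷ []
vectors xs (suc m) = List.cartesianProductWith _∷_ xs (vectors xs m)

vectors-unique : ∀ {A : Set} {xs : List A} m → Unique xs → Unique (vectors xs m)
vectors-unique zero _ = [] ∷ []
vectors-unique (suc m) u = Unique.cartesianProductWith⁺ _∷_ Vec.∷-injective u (vectors-unique m u)

vectors-complete : ∀ {A : Set} {xs : List A} {m} (v : Vec A m) → (∀ i → lookup v i ∈ xs) → v ∈ vectors xs m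
vectors-complete [] _ = here refl
vectors-complete (x ∷ v) p = ∈.∈-cartesianProductWith⁺ _∷_ (p zero) (vectors-complete v (p ∘ suc))

tesler? : ∀ n (A : Mat n) → Dec (Tesler n A)
tesler? n A =
  Fin.all? (λ i → Fin.all? (λ j → (toℕ j <? toℕ i) →-dec (entry A i j ≟ 0)))
  ×-dec Fin.all? (λ k → hook A k ℤ.≟ ℤ.+ 1)

-- T(1^n) exists: Tesler matrices have entries ≤ n, so they are found among finitely many matrices.
teslerCount : ∀ n → Σ ℕ λ t → TeslerCount n t
teslerCount n = _ , count-filter (tesler? n) candidates
  (vectors-unique n (vectors-unique n (Unique.upTo⁺ (suc n))))
  (λ A t → vectors-complete A λ i → vectors-complete (lookup A i) λ j →
     ∈.∈-upTo⁺ (s≤s (≤-trans (entry≤sum ones A (tesler⇒hooks {A = A} t) i j) (≤-reflexive (sum-ones {n})))))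
  where candidates = vectors (vectors (List.upTo (suc n)) n) n

I : ∀ {n} → Mat n
I {zero} = []
I {suc n} = cons 1 zeros I

hooks-I : ∀ {n} → HasHooks ones (I {n})
hooks-I {zero} = (λ ()) , (λ ())
hooks-I {suc n} = hooks-cons⁺ (cong suc (sum-zeros {n})) (HasHooks-subst I (sym (⊕-zeros ones)) hooks-I)

diagonal-I : ∀ {n} → All (_≡ 1) (diagonal (I {n}))
diagonal-I {zero} = []
diagonal-I {suc n} = subst (All (_≡ 1)) (sym (diagonal-cons {a = 1} {r = zeros} {B = I {n}})) (refl ∷ diagonal-I)

unit-diagonal⇒I : ∀ {n} (A : Mat n) → HasHooks ones A → All (_≡ 1) (diagonal A) → A ≡ I
unit-diagonal⇒I {zero} [] _ _ = refl
unit-diagonal⇒I {suc n} A hooks diag with firstRowView A (proj₁ hooks)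
... | firstRow a r B with hooks-cons⁻ hooks | subst (All (_≡ 1)) diagonal-cons diag
... | row , hooksB | refl ∷ diagB with sum≡0⇒zeros r (suc-injective row)
... | refl = cong (cons 1 zeros) (unit-diagonal⇒I B (HasHooks-subst B (⊕-zeros ones) hooksB) diagB)

P : List ℕ → ℕ
P d = product (List.map (λ x → x + 1) d)

-- T d = 2 ^ Σ d; by the trace formula T (diagonal A) = 2 ^ n for A ∈ 𝒯(1^n).
T : List ℕ → ℕ
T d = 2 ^ sum d

dpro≡P : ∀ {n} (A : Mat n) → dpro A ≡ P (diagonal A)
dpro≡P {n} A = cong product (map-∘ (List.allFin n))

P-∷ : ∀ x d → P (x ∷ d) ≡ suc x * P d
P-∷ x d = cong (_* P d) (+-comm x 1)

T-∷ : ∀ x d → T (x ∷ d) ≡ 2 ^ x * T d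
T-∷ x d = ^-distribˡ-+-* 2 x (sum d)

2^x≡1+x : ∀ {x} → x ≤ 1 → 2 ^ x ≡ suc x
2^x≡1+x z≤n = refl
2^x≡1+x (s≤s z≤n) = refl

data OneTwo : List ℕ → Set where
  two  : ∀ {d} → All (_≤ 1) d → OneTwo (2 ∷ d)
  skip : ∀ {x d} → x ≤ 1 → OneTwo d → OneTwo (x ∷ d)

P≡T : ∀ {d} → All (_≤ 1) d → P d ≡ T d
P≡T [] = refl
P≡T {x ∷ d} (x≤1 ∷ d≤1) rewrite P-∷ x d | T-∷ x d | 2^x≡1+x x≤1 = cong (suc x *_) (P≡T d≤1)

4P≡3T : ∀ {d} → OneTwo d → 4 * P d ≡ 3 * T d
4P≡3T {2 ∷ d} (two d≤1) rewrite P-∷ 2 d | T-∷ 2 d | P≡T d≤1 =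
  solve 1 (λ t → con 4 :* (con 3 :* t) := con 3 :* (con 4 :* t)) refl (T d)
4P≡3T {x ∷ d} (skip x≤1 o) rewrite P-∷ x d | T-∷ x d | 2^x≡1+x x≤1 = begin
  4 * (suc x * P d)  ≡⟨ *-exchange 4 (suc x) (P d) ⟩
  suc x * (4 * P d)  ≡⟨ cong (suc x *_) (4P≡3T o) ⟩
  suc x * (3 * T d)  ≡⟨ *-exchange (suc x) 3 (T d) ⟩
  3 * (suc x * T d)  ∎
  where open ≡-Reasoning

1+x≤2^x : ∀ x → suc x ≤ 2 ^ x
1+x≤2^x zero = s≤s z≤n
1+x≤2^x (suc x) = begin
  2 + x             ≤⟨ +-monoʳ-≤ 1 (1+x≤2^x x) ⟩
  1 + 2 ^ x         ≤⟨ +-monoˡ-≤ (2 ^ x) (m^n>0 2 x) ⟩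
  2 ^ x + 2 ^ x     ≡⟨ cong (2 ^ x +_) (sym (+-identityʳ (2 ^ x))) ⟩
  2 ^ suc x         ∎
  where open ≤-Reasoning

P≤T : ∀ d → P d ≤ T d
P≤T [] = s≤s z≤n
P≤T (x ∷ d) rewrite P-∷ x d | T-∷ x d = *-mono-≤ (1+x≤2^x x) (P≤T d)

-- 16 (4 + k) ≤ 9 · 2^(3 + k): an entry ≥ 3 costs a factor at most 9/16.
16[4+k]≤9·2^[3+k] : ∀ k → 16 * (4 + k) ≤ 9 * 2 ^ (3 + k)
16[4+k]≤9·2^[3+k] zero = toWitness {a? = 64 ≤? 72} _
16[4+k]≤9·2^[3+k] (suc k) = begin
  16 * (4 + suc k)                   ≤⟨ *-monoʳ-≤ 16 (+-monoˡ-≤ (4 + k) (s≤s (z≤n {3 + k}))) ⟩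
  16 * ((4 + k) + (4 + k))           ≡⟨ *-distribˡ-+ 16 (4 + k) (4 + k) ⟩
  16 * (4 + k) + 16 * (4 + k)        ≤⟨ +-mono-≤ (16[4+k]≤9·2^[3+k] k) (16[4+k]≤9·2^[3+k] k) ⟩
  9 * 2 ^ (3 + k) + 9 * 2 ^ (3 + k)  ≡⟨ solve 1 (λ p → con 9 :* p :+ con 9 :* p := con 9 :* (con 2 :* p)) refl (2 ^ (3 + k)) ⟩
  9 * 2 ^ (3 + suc k)                ∎
  where open ≤-Reasoning

-- Trichotomy for diagonals: all entries ≤ 1 (P = T), the OneTwo shape (4P = 3T), or
-- P is at most 9/16 of T.  Hence P = T and 4P = 3T characterise the first two shapes.
data Shape (d : List ℕ) : Set where
  binary : All (_≤ 1) d → Shape d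
  oneTwo : OneTwo d → Shape d
  small  : 16 * P d ≤ 9 * T d → Shape d

private
  scale-small : ∀ m p t → 16 * p ≤ 9 * t → 16 * (m * p) ≤ 9 * (m * t)
  scale-small m p t s = begin
    16 * (m * p)  ≡⟨ *-exchange 16 m p ⟩
    m * (16 * p)  ≤⟨ *-monoʳ-≤ m s ⟩
    m * (9 * t)   ≡⟨ *-exchange m 9 t ⟩
    9 * (m * t)   ∎
    where open ≤-Reasoning

  small-∷ : ∀ x d → 16 * (suc x * P d) ≤ 9 * (2 ^ x * T d) → Shape (x ∷ d)
  small-∷ x d s = small (subst₂ (λ p t → 16 * p ≤ 9 * t) (sym (P-∷ x d)) (sym (T-∷ x d)) s)

  prepend≤1 : ∀ {x d} → x ≤ 1 → Shape d → Shape (x ∷ d)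
  prepend≤1 x≤1 (binary b) = binary (x≤1 ∷ b)
  prepend≤1 x≤1 (oneTwo o) = oneTwo (skip x≤1 o)
  prepend≤1 {x} {d} x≤1 (small s) =
    small-∷ x d (subst (λ m → 16 * (suc x * P d) ≤ 9 * (m * T d)) (sym (2^x≡1+x x≤1))
                       (scale-small (suc x) (P d) (T d) s))

  prepend2 : ∀ {d} → Shape d → Shape (2 ∷ d)
  prepend2 (binary b) = oneTwo (two b)
  prepend2 {d} (oneTwo o) = small-∷ 2 d (≤-reflexive (begin
    16 * (3 * P d)  ≡⟨ solve 1 (λ p → con 16 :* (con 3 :* p) := con 12 :* (con 4 :* p)) refl (P d) ⟩
    12 * (4 * P d)  ≡⟨ cong (12 *_) (4P≡3T o) ⟩
    12 * (3 * T d)  ≡⟨ solve 1 (λ t → con 12 :* (con 3 :* t) := con 9 :* (con 4 :* t)) refl (T d) ⟩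
    9 * (4 * T d)   ∎))
    where open ≡-Reasoning
  prepend2 {d} (small s) = small-∷ 2 d (begin
    16 * (3 * P d)  ≡⟨ *-exchange 16 3 (P d) ⟩
    3 * (16 * P d)  ≤⟨ *-monoʳ-≤ 3 s ⟩
    3 * (9 * T d)   ≤⟨ ≤-reflexive (solve 1 (λ t → con 3 :* (con 9 :* t) := con 27 :* t) refl (T d)) ⟩
    27 * T d        ≤⟨ *-monoˡ-≤ (T d) (toWitness {a? = 27 ≤? 36} _) ⟩
    36 * T d        ≡⟨ solve 1 (λ t → con 36 :* t := con 9 :* (con 4 :* t)) refl (T d) ⟩
    9 * (4 * T d)   ∎)
    where open ≤-Reasoning

  prepend≥3 : ∀ k d → Shape (3 + k ∷ d)
  prepend≥3 k d = small-∷ (3 + k) d (begin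
    16 * ((4 + k) * P d)      ≡⟨ sym (*-assoc 16 (4 + k) (P d)) ⟩
    16 * (4 + k) * P d        ≤⟨ *-mono-≤ (16[4+k]≤9·2^[3+k] k) (P≤T d) ⟩
    9 * 2 ^ (3 + k) * T d     ≡⟨ *-assoc 9 (2 ^ (3 + k)) (T d) ⟩
    9 * (2 ^ (3 + k) * T d)   ∎)
    where open ≤-Reasoning

shape : ∀ d → Shape d
shape [] = binary []
shape (0 ∷ d) = prepend≤1 z≤n (shape d)
shape (1 ∷ d) = prepend≤1 (s≤s z≤n) (shape d)
shape (2 ∷ d) = prepend2 (shape d)
shape (suc (suc (suc k)) ∷ d) = prepend≥3 k d

binary-sum≤ : ∀ {d} → All (_≤ 1) d → sum d ≤ length d
binary-sum≤ [] = z≤n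
binary-sum≤ (x≤1 ∷ d≤1) = +-mono-≤ x≤1 (binary-sum≤ d≤1)

oneTwo-sum≤ : ∀ {d} → OneTwo d → sum d ≤ suc (length d)
oneTwo-sum≤ (two d≤1) = s≤s (s≤s (binary-sum≤ d≤1))
oneTwo-sum≤ (skip x≤1 o) = +-mono-≤ x≤1 (oneTwo-sum≤ o)

binary-full : ∀ {d} → All (_≤ 1) d → sum d ≡ length d → All (_≡ 1) d
binary-full [] _ = []
binary-full {0 ∷ d} (_ ∷ d≤1) eq = ⊥-elim (<⇒≱ (s≤s ≤-refl) (≤-trans (≤-reflexive (sym eq)) (binary-sum≤ d≤1)))
binary-full {1 ∷ d} (_ ∷ d≤1) eq = refl ∷ binary-full d≤1 (suc-injective eq)
binary-full {suc (suc _) ∷ d} (s≤s () ∷ _) _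

data AtMostOneNonzero : List ℕ → Set where
  none  : AtMostOneNonzero []
  zero∷ : ∀ {d} → AtMostOneNonzero d → AtMostOneNonzero (0 ∷ d)
  last  : ∀ {d} x → All (_≡ 0) d → AtMostOneNonzero (x ∷ d)

1+sum≤P : ∀ d → suc (sum d) ≤ P d
1+sum≤P [] = s≤s z≤n
1+sum≤P (x ∷ d) rewrite P-∷ x d = begin
  suc (x + sum d)          ≡⟨ cong suc (+-comm x (sum d)) ⟩
  suc (sum d) + x          ≤⟨ +-monoʳ-≤ (suc (sum d)) (m≤m*n x (suc (sum d))) ⟩
  suc x * suc (sum d)      ≤⟨ *-monoʳ-≤ (suc x) (1+sum≤P d) ⟩
  suc x * P d              ∎
  where open ≤-Reasoning

sum≡0⇒all0 : ∀ d → sum d ≡ 0 → All (_≡ 0) d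
sum≡0⇒all0 [] _ = []
sum≡0⇒all0 (zero ∷ d) eq = refl ∷ sum≡0⇒all0 d eq

P≡1+sum⇒ : ∀ d → P d ≡ suc (sum d) → AtMostOneNonzero d
P≡1+sum⇒ [] _ = none
P≡1+sum⇒ (zero ∷ d) eq = zero∷ (P≡1+sum⇒ d (trans (sym (+-identityʳ (P d))) eq))
P≡1+sum⇒ (suc y ∷ d) eq with sum d in sum≡
... | zero = last _ (sum≡0⇒all0 d sum≡)
... | suc s = ⊥-elim (<-irrefl eq′ (≤-trans strict (*-monoʳ-≤ (2 + y) (subst (λ t → suc t ≤ P d) sum≡ (1+sum≤P d)))))
  where
    eq′ : 2 + (y + suc s) ≡ (2 + y) * P d
    eq′ = trans (sym eq) (P-∷ (suc y) d)
    strict : 3 + (y + suc s) ≤ (2 + y) * (2 + s)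
    strict = ≤-trans (m≤m+n (3 + (y + suc s)) (y + s + y * s))
      (≤-reflexive (solve 2 (λ y s → con 3 :+ (y :+ (con 1 :+ s)) :+ (y :+ s :+ y :* s)
                                   := (con 2 :+ y) :* (con 2 :+ s)) refl y s))

diagonal-PT : ∀ {n a} (A : Mat n) → HasHooks ones A → dpro A ≡ a →
              P (diagonal A) ≡ a × T (diagonal A) ≡ 2 ^ n
diagonal-PT A hooks dpro≡a = trans (sym (dpro≡P A)) dpro≡a , cong (2 ^_) (trace-tesler A hooks)

-- A Tesler matrix whose diagonal entries are all ≤ 1 is the identity (they sum to n).
binary-diagonal⇒I : ∀ {n} (A : Mat n) → HasHooks ones A → All (_≤ 1) (diagonal A) → A ≡ I
binary-diagonal⇒I A hooks b =
  unit-diagonal⇒I A hooks (binary-full b (trans (trace-tesler A hooks) (sym (length-diagonal A))))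

coeff-2^n : ∀ n → ArmstrongCoeff n (2 ^ n) 1
coeff-2^n n = count-cong (λ { A refl → hooks⇒tesler {A = I} hooks-I , dpro-I }) only-I (count-single I)
  where
    instance
      2^n≢0 : NonZero (2 ^ n)
      2^n≢0 = m^n≢0 2 n

    dpro-I : dpro (I {n}) ≡ 2 ^ n
    dpro-I = trans (dpro≡P (I {n})) (trans (P≡T (All.map (λ { refl → s≤s z≤n }) (diagonal-I {n})))
                                           (cong (2 ^_) (trace-tesler (I {n}) hooks-I)))

    only-I : ∀ A → Tesler n A × dpro A ≡ 2 ^ n → A ≡ I
    only-I A (tesler , dpro≡) = from-shape (shape (diagonal A))
      where
        hooks : HasHooks ones A
        hooks = tesler⇒hooks {A = A} tesler

        P≡ : P (diagonal A) ≡ 2 ^ n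
        P≡ = proj₁ (diagonal-PT A hooks dpro≡)

        T≡ : T (diagonal A) ≡ 2 ^ n
        T≡ = proj₂ (diagonal-PT A hooks dpro≡)

        from-shape : Shape (diagonal A) → A ≡ I
        from-shape (binary b) = binary-diagonal⇒I A hooks b
        from-shape (oneTwo o) with *-cancelʳ-≡ 4 3 (2 ^ n) (subst₂ (λ p t → 4 * p ≡ 3 * t) P≡ T≡ (4P≡3T o))
        ... | ()
        from-shape (small s) =
          ⊥-elim (toWitnessFalse {a? = 16 ≤? 9} _ (*-cancelʳ-≤ 16 9 (2 ^ n) (subst₂ (λ p t → 16 * p ≤ 9 * t) P≡ T≡ s)))

bump : ∀ {n} → Fin n → Vec ℕ n
bump zero = 2 ∷ ones
bump (suc t) = 1 ∷ bump t

-- The hooks of the block under a first row (a, unit s) in a Tesler matrix.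
ones⊕unit : ∀ {n} (s : Fin n) → ones ⊕ unit s ≡ bump s
ones⊕unit zero = cong (2 ∷_) (⊕-zeros ones)
ones⊕unit (suc s) = cong (1 ∷_) (ones⊕unit s)

sum-bump : ∀ {n} (s : Fin n) → Vec.sum (bump s) ≡ suc n
sum-bump {suc n} zero = cong (2 +_) (sum-ones {n})
sum-bump (suc s) = cong suc (sum-bump s)

OneTwoWith : ∀ {n} → Vec ℕ n → Mat n → Set
OneTwoWith h A = HasHooks h A × OneTwo (diagonal A)

-- A OneTwo diagonal sums to at most n + 1, so by the trace formula no such matrix has
-- hooks summing to n + 2.
no-overflow : ∀ {n} (h : Vec ℕ n) (B : Mat n) → Vec.sum h ≡ 2 + n → ¬ OneTwoWith h B
no-overflow {n} h B sum≡ (hooks , o) = <-irrefl refl (begin-strict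
  2 + n                      ≡⟨ sym (trans (trace h B hooks) sum≡) ⟩
  sum (diagonal B)           ≤⟨ oneTwo-sum≤ o ⟩
  suc (length (diagonal B))  ≡⟨ cong suc (length-diagonal B) ⟩
  suc n                      <⟨ n<1+n (suc n) ⟩
  2 + n                      ∎)
  where open ≤-Reasoning

data OneTwoRow {n} (h : ℕ) (hs : Vec ℕ n) : Mat (suc n) → Set where
  twoRow  : ∀ r B → 2 + Vec.sum r ≡ h → HasHooks (hs ⊕ r) B → All (_≤ 1) (diagonal B) →
            OneTwoRow h hs (cons 2 r B)
  skipRow : ∀ a r B → a ≤ 1 → a + Vec.sum r ≡ h → OneTwoWith (hs ⊕ r) B →
            OneTwoRow h hs (cons a r B)

oneTwoRow : ∀ {n h hs} (A : Mat (suc n)) → OneTwoWith (h ∷ hs) A → OneTwoRow h hs A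
oneTwoRow A (hooks , o) with firstRowView A (proj₁ hooks)
... | firstRow a r B with hooks-cons⁻ hooks | subst OneTwo (diagonal-cons {a = a} {r = r} {B = B}) o
... | row , hooksB | two b = twoRow r B row hooksB b
... | row , hooksB | skip a≤1 oB = skipRow a r B a≤1 row (hooksB , oB)

oneTwoRow⁻¹ : ∀ {n h hs} {A : Mat (suc n)} → OneTwoRow h hs A → OneTwoWith (h ∷ hs) A
oneTwoRow⁻¹ (twoRow r B row hooksB b) =
  hooks-cons⁺ row hooksB , subst OneTwo (sym (diagonal-cons {a = 2} {r = r} {B = B})) (two b)
oneTwoRow⁻¹ (skipRow a r B a≤1 row (hooksB , oB)) =
  hooks-cons⁺ row hooksB , subst OneTwo (sym (diagonal-cons {a = a} {r = r} {B = B})) (skip a≤1 oB)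

-- The number of matrices with hooks bump s and OneTwo diagonal: 2^(n-1-s) for s : Fin n.
bumpCount : ∀ {n} → Fin n → ℕ
bumpCount {suc n} zero = 2 ^ n
bumpCount (suc t) = bumpCount t

1+sum-bumpCount : ∀ n → 1 + sumFin (bumpCount {n}) ≡ 2 ^ n
1+sum-bumpCount zero = refl
1+sum-bumpCount (suc n) = begin
  1 + (2 ^ n + sumFin (bumpCount {n}))  ≡⟨ sym (+-suc (2 ^ n) (sumFin (bumpCount {n}))) ⟩
  2 ^ n + (1 + sumFin (bumpCount {n}))  ≡⟨ cong (2 ^ n +_) (1+sum-bumpCount n) ⟩
  2 ^ n + 2 ^ n                         ≡⟨ cong (2 ^ n +_) (sym (+-identityʳ (2 ^ n))) ⟩
  2 ^ suc n                             ∎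
  where open ≡-Reasoning

ConsOf : ∀ {n} → ℕ → Vec ℕ n → (Mat n → Set) → Mat (suc n) → Set
ConsOf {n} a r Q A = Σ (Mat n) λ B → Q B × cons a r B ≡ A

count-ConsOf : ∀ {n a} {r : Vec ℕ n} {Q : Mat n → Set} {c} → HasCount Q c → HasCount (ConsOf a r Q) c
count-ConsOf {a = a} {r} = count-image (cons a r) (λ _ _ → cons-injectiveʳ)

ConsOf-unit-disjoint : ∀ {n a} (Q : Fin n → Mat n → Set) s t A →
                       ConsOf a (unit s) (Q s) A → ConsOf a (unit t) (Q t) A → s ≡ t
ConsOf-unit-disjoint Q s t A (B , _ , refl) (_ , _ , eq) = unit-injective (sym (proj₁ (proj₂ (cons-injective eq))))

bump₀-split : ∀ {n} (A : Mat (suc n)) → OneTwoWith (bump zero) A →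
              A ≡ cons 2 zeros I ⊎ Σ (Fin n) λ t → ConsOf 1 (unit t) (OneTwoWith (bump t)) A
bump₀-split {n} A q with oneTwoRow A q
... | twoRow r B row hooksB b with sum≡0⇒zeros r (suc-injective (suc-injective row))
...   | refl = inj₁ (cong (cons 2 zeros) (binary-diagonal⇒I B (HasHooks-subst B (⊕-zeros ones) hooksB) b))
bump₀-split {n} A q | skipRow 0 r B z≤n row qB =
  ⊥-elim (no-overflow (ones ⊕ r) B (trans (sum-⊕ ones r) (trans (cong₂ _+_ (sum-ones {n}) row) (+-comm n 2))) qB)
bump₀-split {n} A q | skipRow 1 r B (s≤s z≤n) row (hooksB , oB) with sum≡1⇒unit r (suc-injective row)
... | t , refl = inj₂ (t , B , (HasHooks-subst B (ones⊕unit t) hooksB , oB) , refl)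

bump₀-split⁻¹ : ∀ {n} (A : Mat (suc n)) →
                A ≡ cons 2 zeros I ⊎ Σ (Fin n) (λ t → ConsOf 1 (unit t) (OneTwoWith (bump t)) A) →
                OneTwoWith (bump zero) A
bump₀-split⁻¹ {n} A (inj₁ refl) = oneTwoRow⁻¹ (twoRow zeros I (cong (2 +_) (sum-zeros {n}))
  (HasHooks-subst I (sym (⊕-zeros ones)) hooks-I) (All.map (λ { refl → s≤s z≤n }) diagonal-I))
bump₀-split⁻¹ A (inj₂ (t , B , (hooksB , oB) , refl)) = oneTwoRow⁻¹ (skipRow 1 (unit t) B (s≤s z≤n)
  (cong suc (sum-unit t)) (HasHooks-subst B (sym (ones⊕unit t)) hooksB , oB))

bump-suc-split : ∀ {n} (t : Fin n) (A : Mat (suc n)) → OneTwoWith (bump (suc t)) A →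
                 ConsOf 1 zeros (OneTwoWith (bump t)) A
bump-suc-split {n} t A q with oneTwoRow A q
... | twoRow r B () _ _
... | skipRow 0 r B z≤n row qB =
  ⊥-elim (no-overflow (bump t ⊕ r) B (trans (sum-⊕ (bump t) r) (trans (cong₂ _+_ (sum-bump t) row) (+-comm (suc n) 1))) qB)
... | skipRow 1 r B (s≤s z≤n) row (hooksB , oB) with sum≡0⇒zeros r (suc-injective row)
...   | refl = B , (HasHooks-subst B (⊕-zeros (bump t)) hooksB , oB) , refl

bump-suc-split⁻¹ : ∀ {n} (t : Fin n) (A : Mat (suc n)) → ConsOf 1 zeros (OneTwoWith (bump t)) A →
                   OneTwoWith (bump (suc t)) A
bump-suc-split⁻¹ {n} t A (B , (hooksB , oB) , refl) = oneTwoRow⁻¹ (skipRow 1 zeros B (s≤s z≤n)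
  (cong suc (sum-zeros {n})) (HasHooks-subst B (sym (⊕-zeros (bump t))) hooksB , oB))

count-bump : ∀ n (s : Fin n) → HasCount (OneTwoWith (bump s)) (bumpCount s)
count-bump (suc n) zero = subst (HasCount _) (1+sum-bumpCount n)
  (count-cong bump₀-split⁻¹ bump₀-split
    (count-⊎ (count-single (cons 2 zeros I))
             (count-⋃ n (λ t → ConsOf 1 (unit t) (OneTwoWith (bump t))) bumpCount
                      (λ t → count-ConsOf (count-bump n t))
                      (ConsOf-unit-disjoint (λ t → OneTwoWith (bump t))))
             (λ { A refl (t , B , _ , eq) → 1≢2 (proj₁ (cons-injective eq)) })))
  where
    1≢2 : 1 ≢ 2
    1≢2 ()
count-bump (suc n) (suc t) = count-cong (bump-suc-split⁻¹ t) (bump-suc-split t) (count-ConsOf (count-bump n t))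

tesler-oneTwo-split : ∀ {n} (A : Mat (suc n)) → OneTwoWith ones A →
  ConsOf 1 zeros (OneTwoWith ones) A ⊎ Σ (Fin n) λ s → ConsOf 0 (unit s) (OneTwoWith (bump s)) A
tesler-oneTwo-split A q with oneTwoRow A q
... | twoRow r B () _ _
... | skipRow 0 r B z≤n row (hooksB , oB) with sum≡1⇒unit r row
...   | s , refl = inj₂ (s , B , (HasHooks-subst B (ones⊕unit s) hooksB , oB) , refl)
tesler-oneTwo-split A q | skipRow 1 r B (s≤s z≤n) row (hooksB , oB) with sum≡0⇒zeros r (suc-injective row)
...   | refl = inj₁ (B , (HasHooks-subst B (⊕-zeros ones) hooksB , oB) , refl)

tesler-oneTwo-split⁻¹ : ∀ {n} (A : Mat (suc n)) →
  ConsOf 1 zeros (OneTwoWith ones) A ⊎ Σ (Fin n) (λ s → ConsOf 0 (unit s) (OneTwoWith (bump s)) A) →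
  OneTwoWith ones A
tesler-oneTwo-split⁻¹ {n} A (inj₁ (B , (hooksB , oB) , refl)) = oneTwoRow⁻¹ (skipRow 1 zeros B (s≤s z≤n)
  (cong suc (sum-zeros {n})) (HasHooks-subst B (sym (⊕-zeros ones)) hooksB , oB))
tesler-oneTwo-split⁻¹ A (inj₂ (s , B , (hooksB , oB) , refl)) = oneTwoRow⁻¹ (skipRow 0 (unit s) B z≤n
  (sum-unit s) (HasHooks-subst B (sym (ones⊕unit s)) hooksB , oB))

oneTwoCount : ℕ → ℕ
oneTwoCount zero = 0
oneTwoCount (suc n) = oneTwoCount n + sumFin (bumpCount {n})

oneTwoCount≡ : ∀ n → oneTwoCount n + n + 1 ≡ 2 ^ n
oneTwoCount≡ zero = refl
oneTwoCount≡ (suc n) = begin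
  oneTwoCount n + sumFin (bumpCount {n}) + suc n + 1
    ≡⟨ solve 3 (λ a b c → a :+ b :+ (con 1 :+ c) :+ con 1 := (a :+ c :+ con 1) :+ (con 1 :+ b)) refl
             (oneTwoCount n) (sumFin (bumpCount {n})) n ⟩
  (oneTwoCount n + n + 1) + (1 + sumFin (bumpCount {n}))  ≡⟨ cong₂ _+_ (oneTwoCount≡ n) (1+sum-bumpCount n) ⟩
  2 ^ n + 2 ^ n                                          ≡⟨ cong (2 ^ n +_) (sym (+-identityʳ (2 ^ n))) ⟩
  2 ^ suc n                                              ∎
  where open ≡-Reasoning

count-tesler-oneTwo : ∀ n → HasCount (OneTwoWith (ones {n})) (oneTwoCount n)
count-tesler-oneTwo zero = count-none (λ { A (_ , ()) })
count-tesler-oneTwo (suc n) = count-cong tesler-oneTwo-split⁻¹ tesler-oneTwo-split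
  (count-⊎ (count-ConsOf (count-tesler-oneTwo n))
           (count-⋃ n (λ s → ConsOf 0 (unit s) (OneTwoWith (bump s))) bumpCount
                    (λ s → count-ConsOf (count-bump n s))
                    (ConsOf-unit-disjoint (λ s → OneTwoWith (bump s))))
           (λ { A (B , _ , refl) (s , B′ , _ , eq) → 0≢1 (proj₁ (cons-injective eq)) }))
  where
    0≢1 : 0 ≢ 1
    0≢1 ()

-- Part (3): [q^(3·2^m)] A_(m+2)(q) = 2^(m+2) - (m+2) - 1.  Since T = 4·2^m, dpro = 3·2^m means
-- 4P = 3T, which by the shape trichotomy is exactly a OneTwo diagonal.
coeff-3·2^m : ∀ m → ArmstrongCoeff (2 + m) (3 * 2 ^ m) (2 ^ (2 + m) ∸ (2 + m) ∸ 1)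
coeff-3·2^m m = subst (HasCount _) count≡ (count-cong to from (count-tesler-oneTwo n))
  where
    n = 2 + m
    instance
      2^m≢0 : NonZero (2 ^ m)
      2^m≢0 = m^n≢0 2 m

    count≡ : oneTwoCount n ≡ 2 ^ n ∸ n ∸ 1
    count≡ = begin
      oneTwoCount n                  ≡⟨ sym (m+n∸n≡m (oneTwoCount n) 1) ⟩
      oneTwoCount n + 1 ∸ 1          ≡⟨ cong (_∸ 1) (sym (m+n∸n≡m (oneTwoCount n + 1) n)) ⟩
      oneTwoCount n + 1 + n ∸ n ∸ 1  ≡⟨ cong (λ x → x ∸ n ∸ 1) (trans (+-assoc (oneTwoCount n) 1 n)
                                         (trans (cong (oneTwoCount n +_) (+-comm 1 n)) (sym (+-assoc (oneTwoCount n) n 1)))) ⟩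
      oneTwoCount n + n + 1 ∸ n ∸ 1  ≡⟨ cong (λ x → x ∸ n ∸ 1) (oneTwoCount≡ n) ⟩
      2 ^ n ∸ n ∸ 1                  ∎
      where open ≡-Reasoning

    2^n≡4·2^m : 2 ^ n ≡ 4 * 2 ^ m
    2^n≡4·2^m = solve 1 (λ x → con 2 :* (con 2 :* x) := con 4 :* x) refl (2 ^ m)

    to : ∀ A → OneTwoWith ones A → Tesler n A × dpro A ≡ 3 * 2 ^ m
    to A (hooks , o) = hooks⇒tesler {A = A} hooks , trans (dpro≡P A) (*-cancelˡ-≡ (P (diagonal A)) (3 * 2 ^ m) 4 (begin
      4 * P (diagonal A)  ≡⟨ 4P≡3T o ⟩
      3 * T (diagonal A)  ≡⟨ cong (3 *_) (trans (proj₂ (diagonal-PT A hooks refl)) 2^n≡4·2^m) ⟩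
      3 * (4 * 2 ^ m)     ≡⟨ *-exchange 3 4 (2 ^ m) ⟩
      4 * (3 * 2 ^ m)     ∎))
      where open ≡-Reasoning

    from : ∀ A → Tesler n A × dpro A ≡ 3 * 2 ^ m → OneTwoWith ones A
    from A (tesler , dpro≡) = hooks , from-shape (shape (diagonal A))
      where
        hooks : HasHooks ones A
        hooks = tesler⇒hooks {A = A} tesler

        P≡ : P (diagonal A) ≡ 3 * 2 ^ m
        P≡ = proj₁ (diagonal-PT A hooks dpro≡)

        T≡ : T (diagonal A) ≡ 4 * 2 ^ m
        T≡ = trans (proj₂ (diagonal-PT A hooks dpro≡)) 2^n≡4·2^m

        from-shape : Shape (diagonal A) → OneTwo (diagonal A)
        from-shape (oneTwo o) = o
        from-shape (binary b) with *-cancelʳ-≡ 3 4 (2 ^ m) (trans (sym P≡) (trans (P≡T b) T≡))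
        ... | ()
        from-shape (small s) = ⊥-elim (toWitnessFalse {a? = 48 ≤? 36} _ (*-cancelʳ-≤ 48 36 (2 ^ m) (begin
          48 * 2 ^ m          ≡⟨ *-assoc 16 3 (2 ^ m) ⟩
          16 * (3 * 2 ^ m)    ≡⟨ cong (16 *_) (sym P≡) ⟩
          16 * P (diagonal A) ≤⟨ s ⟩
          9 * T (diagonal A)  ≡⟨ cong (9 *_) T≡ ⟩
          9 * (4 * 2 ^ m)     ≡⟨ *-assoc 9 4 (2 ^ m) ⟨
          36 * 2 ^ m          ∎)))
          where open ≤-Reasoning

-- Move the diagonal entry of every row to the end of that row (shifting the row one step to
-- the right), and put c plus the trace into the new bottom-right corner.
pushDiag : ∀ {m} → ℕ → Mat m → Mat (suc m)
pushDiag {zero} c [] = cons c [] []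
pushDiag {suc m} c ((a ∷ r) ∷ rows) = cons 0 (r ∷ʳ a) (pushDiag (c + a) (Vec.map Vec.tail rows))

pushDiag-cons : ∀ {m} c a (r : Vec ℕ m) (B : Mat m) →
                pushDiag c (cons a r B) ≡ cons 0 (r ∷ʳ a) (pushDiag (c + a) B)
pushDiag-cons c a r B = cong (λ X → cons 0 (r ∷ʳ a) (pushDiag (c + a) X)) (tail-map B)
  where
    tail-map : ∀ {m k} (X : Vec (Vec ℕ k) m) → Vec.map Vec.tail (Vec.map (0 ∷_) X) ≡ X
    tail-map [] = refl
    tail-map (x ∷ X) = cong (x ∷_) (tail-map X)

data ZeroButLast : List ℕ → Set where
  [_]   : ∀ x → ZeroButLast (x ∷ [])
  zero∷ : ∀ {d} → ZeroButLast d → ZeroButLast (0 ∷ d)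

P-ZeroButLast : ∀ {d} → ZeroButLast d → P d ≡ suc (sum d)
P-ZeroButLast [ x ] = trans (*-identityʳ (x + 1)) (trans (+-comm x 1) (cong suc (sym (+-identityʳ x))))
P-ZeroButLast {0 ∷ d} (zero∷ z) = trans (+-identityʳ (P d)) (P-ZeroButLast z)

pushDiag-diagonal : ∀ {m} c (C : Mat m) → ZeroButLast (diagonal (pushDiag c C))
pushDiag-diagonal {zero} c [] = subst ZeroButLast (sym (diagonal-cons {a = c} {r = []} {B = []})) [ c ]
pushDiag-diagonal {suc m} c ((a ∷ r) ∷ rows) =
  subst ZeroButLast (sym (diagonal-cons {a = 0} {r = r ∷ʳ a} {B = pushDiag (c + a) (Vec.map Vec.tail rows)}))
        (zero∷ (pushDiag-diagonal (c + a) (Vec.map Vec.tail rows)))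

private
  ⊕-∷ʳ : ∀ {n} (u v : Vec ℕ n) x y → (u ∷ʳ x) ⊕ (v ∷ʳ y) ≡ (u ⊕ v) ∷ʳ (x + y)
  ⊕-∷ʳ [] [] x y = refl
  ⊕-∷ʳ (a ∷ u) (b ∷ v) x y = cong (a + b ∷_) (⊕-∷ʳ u v x y)

  sum-∷ʳ : ∀ {n} a (r : Vec ℕ n) → Vec.sum (r ∷ʳ a) ≡ a + Vec.sum r
  sum-∷ʳ a [] = refl
  sum-∷ʳ a (x ∷ r) = trans (cong (x +_) (sum-∷ʳ a r)) (solve 3 (λ x a s → x :+ (a :+ s) := a :+ (x :+ s)) refl x a (Vec.sum r))

-- pushDiag c turns hooks h into hooks h ∷ʳ c: every row keeps its sum, and the column sum that
-- the diagonal entries no longer contribute is added to the corner.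
pushDiag-hooks : ∀ {m} (h : Vec ℕ m) c (C : Mat m) → HasHooks h C → HasHooks (h ∷ʳ c) (pushDiag c C)
pushDiag-hooks [] c [] _ = hooks-cons⁺ {a = c} {r = []} {B = []} (+-identityʳ c) ((λ ()) , (λ ()))
pushDiag-hooks (h ∷ hs) c C hooks with firstRowView C (proj₁ hooks)
... | firstRow a r B with hooks-cons⁻ hooks
... | row , hooksB = subst (HasHooks ((h ∷ hs) ∷ʳ c)) (sym (pushDiag-cons c a r B))
  (hooks-cons⁺ (trans (sum-∷ʳ a r) row)
    (HasHooks-subst (pushDiag (c + a) B) (sym (⊕-∷ʳ hs r c a)) (pushDiag-hooks (hs ⊕ r) (c + a) B hooksB)))

pushDiag-injective : ∀ {m} c (C C′ : Mat m) → UpperTriangular C → UpperTriangular C′ →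
                     pushDiag c C ≡ pushDiag c C′ → C ≡ C′
pushDiag-injective c [] [] _ _ _ = refl
pushDiag-injective {suc m} c C C′ ut ut′ eq with firstRowView C ut | firstRowView C′ ut′
... | firstRow a r B | firstRow a′ r′ B′
  with cons-injective (trans (sym (pushDiag-cons c a r B)) (trans eq (pushDiag-cons c a′ r′ B′)))
... | _ , row≡ , block≡ with Vec.∷ʳ-injective r r′ row≡
... | refl , refl = cong (cons a r)
  (pushDiag-injective (c + a) B B′ (upper-cons⁻ {a = a} {r = r} ut) (upper-cons⁻ {a = a} {r = r} ut′) block≡)

pushDiag-onto : ∀ {m} (h : Vec ℕ m) c (A : Mat (suc m)) → HasHooks (h ∷ʳ c) A → ZeroButLast (diagonal A) →
                Σ (Mat m) λ C → HasHooks h C × pushDiag c C ≡ A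
pushDiag-onto [] c A hooks _ with firstRowView A (proj₁ hooks)
... | firstRow a [] [] = [] , ((λ ()) , (λ ())) , cong (λ x → cons x [] []) (sym (trans (sym (+-identityʳ a)) (proj₁ (hooks-cons⁻ hooks))))
pushDiag-onto (h ∷ hs) c A hooks z with firstRowView A (proj₁ hooks)
... | firstRow a r B with hooks-cons⁻ hooks | subst ZeroButLast (diagonal-cons {a = a} {r = r} {B = B}) z
... | row , hooksB | zero∷ zB with Vec.initLast r
... | r′ , a′ , refl with pushDiag-onto (hs ⊕ r′) (c + a′) B (HasHooks-subst B (⊕-∷ʳ hs r′ c a′) hooksB) zB
... | C′ , hooksC′ , pushed =
  cons a′ r′ C′ , hooks-cons⁺ (trans (sym (sum-∷ʳ a′ r′)) row) hooksC′ ,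
  trans (pushDiag-cons c a′ r′ C′) (cong (cons 0 (r′ ∷ʳ a′)) pushed)

private
  sum-all0 : ∀ {d} → All (_≡ 0) d → sum d ≡ 0
  sum-all0 [] = refl
  sum-all0 (refl ∷ z) = sum-all0 z

-- When all hooks are positive, a diagonal with at most one nonzero entry can only be nonzero
-- at the end: a nonzero entry followed by zeros would leave a block with positive hooks and
-- zero trace.
positive-hooks⇒ZeroButLast : ∀ {n} (h : Vec ℕ (suc n)) (A : Mat (suc n)) → HasHooks h A →
                             (∀ k → 1 ≤ lookup h k) → AtMostOneNonzero (diagonal A) → ZeroButLast (diagonal A)
positive-hooks⇒ZeroButLast {zero} h A hooks _ _ with firstRowView A (proj₁ hooks)
... | firstRow a [] [] = [ a ]
positive-hooks⇒ZeroButLast {suc n} (h ∷ hs) A hooks pos am with firstRowView A (proj₁ hooks)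
... | firstRow a r B with hooks-cons⁻ hooks | subst AtMostOneNonzero (diagonal-cons {a = a} {r = r} {B = B}) am
... | _ , hooksB | zero∷ amB =
  subst ZeroButLast (sym (diagonal-cons {a = a} {r = r} {B = B})) (zero∷ (positive-hooks⇒ZeroButLast (hs ⊕ r) B hooksB posB amB))
  where
    posB : ∀ k → 1 ≤ lookup (hs ⊕ r) k
    posB k = ≤-trans (pos (suc k)) (≤-trans (m≤m+n (lookup hs k) (lookup r k)) (≤-reflexive (sym (Vec.lookup-zipWith _+_ k hs r))))
... | _ , hooksB | last _ zerosB with ≤-trans (pos (suc zero)) (begin
      lookup hs zero          ≤⟨ lookup≤sum hs zero ⟩
      Vec.sum hs              ≤⟨ m≤m+n (Vec.sum hs) (Vec.sum r) ⟩
      Vec.sum hs + Vec.sum r  ≡⟨ sum-⊕ hs r ⟨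
      Vec.sum (hs ⊕ r)        ≡⟨ trace (hs ⊕ r) B hooksB ⟨
      sum (diagonal B)        ≡⟨ sum-all0 zerosB ⟩
      0                       ∎)
  where open ≤-Reasoning
... | ()

-- Part (2): [q^(n+1)] A_n(q) = T(1^(n-1)).  As P d ≥ 1 + Σ d = n + 1, dpro = n + 1 forces at most
-- one nonzero diagonal entry, necessarily the last, and pushDiag 1 is a bijection onto these.
coeff-n+1 : ∀ m → Σ ℕ λ t → TeslerCount (suc m) t × ArmstrongCoeff (2 + m) (2 + m + 1) t
coeff-n+1 m = t , tesler-count , count-cong to from (count-image (pushDiag 1) injective tesler-count)
  where
    n = 2 + m
    t = proj₁ (teslerCount (suc m))
    tesler-count = proj₂ (teslerCount (suc m))

    ones∷ʳ1 : ∀ {k} → ones {k} ∷ʳ 1 ≡ ones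
    ones∷ʳ1 {zero} = refl
    ones∷ʳ1 {suc k} = cong (1 ∷_) (ones∷ʳ1 {k})

    injective : ∀ {C C′} → Tesler (suc m) C → Tesler (suc m) C′ → pushDiag 1 C ≡ pushDiag 1 C′ → C ≡ C′
    injective {C} {C′} tesler tesler′ = pushDiag-injective 1 C C′ (proj₁ tesler) (proj₁ tesler′)

    to : ∀ A → Σ (Mat (suc m)) (λ C → Tesler (suc m) C × pushDiag 1 C ≡ A) → Tesler n A × dpro A ≡ n + 1
    to A (C , tesler , refl) = hooks⇒tesler {A = A} hooks , (begin
      dpro A                ≡⟨ dpro≡P A ⟩
      P (diagonal A)        ≡⟨ P-ZeroButLast (pushDiag-diagonal 1 C) ⟩
      suc (sum (diagonal A)) ≡⟨ cong suc (trace-tesler A hooks) ⟩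
      suc n                 ≡⟨ +-comm 1 n ⟩
      n + 1                 ∎)
      where
        open ≡-Reasoning
        hooks : HasHooks ones A
        hooks = HasHooks-subst A ones∷ʳ1 (pushDiag-hooks ones 1 C (tesler⇒hooks {A = C} tesler))

    from : ∀ A → Tesler n A × dpro A ≡ n + 1 → Σ (Mat (suc m)) (λ C → Tesler (suc m) C × pushDiag 1 C ≡ A)
    from A (tesler , dpro≡) =
      let C , hooksC , pushed = pushDiag-onto ones 1 A (HasHooks-subst A (sym ones∷ʳ1) hooks) zero-but-last
      in C , hooks⇒tesler {A = C} hooksC , pushed
      where
        hooks : HasHooks ones A
        hooks = tesler⇒hooks {A = A} tesler

        P≡1+sum : P (diagonal A) ≡ suc (sum (diagonal A))
        P≡1+sum = trans (proj₁ (diagonal-PT A hooks dpro≡)) (trans (+-comm n 1) (cong suc (sym (trace-tesler A hooks))))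

        zero-but-last : ZeroButLast (diagonal A)
        zero-but-last = positive-hooks⇒ZeroButLast ones A hooks (λ k → ≤-reflexive (sym (lookup-ones k)))
                                                   (P≡1+sum⇒ (diagonal A) P≡1+sum)

mainTheorem11 : (n : ℕ) → 2 ≤ n →
    ArmstrongCoeff n (2 ^ n) 1
    × Σ ℕ (λ t → TeslerCount (n ∸ 1) t × ArmstrongCoeff n (n + 1) t)
    × ArmstrongCoeff n (3 * 2 ^ (n ∸ 2)) (2 ^ n ∸ n ∸ 1)
mainTheorem11 (suc (suc m)) (s≤s (s≤s z≤n)) = coeff-2^n (2 + m) , coeff-n+1 m , coeff-3·2^m m
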